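{- Let $a\in\mathbb{Z}$ with $3\nmid a$, and let $f_a(x) = -8ax^3-(8a+2)x^2+(4a-1)x+a$. Then $f_a$ is irreducible (over $\mathbb{Q}$) and has emergent reducibility at depth $1$; that is, $f_a$ is irreducible over $\mathbb{Q}$ while $f_a\circ f_a$ is reducible over $\mathbb{Q}$.
   Context: For a field $K$ and $f\in K[x]$, write $f^{\circ 0}=f$ and $f^{\circ k}=f\circ f^{\circ (k-1)}$. The polynomial $f$ has emergent reducibility at depth $n$ over $K$ if $f^{\circ i}$ is irreducible over $K$ for $0\le i\le n-1$ and $f^{\circ n}$ is reducible over $K$. Here $K=\mathbb{Q}$. -}

module Defs where

open import Data.Nat using (ℕ; zero; suc; _<_; _≤_)
open import Data.Integer as ℤ using (ℤ; +_)
open import Data.Rational as ℚ using (ℚ; 0ℚ; _/_)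
open import Data.List using (List; []; _∷_; map)
open import Data.Sum using (_⊎_)
open import Data.Product using (_×_)
open import Relation.Nullary using (¬_)
open import Relation.Binary.PropositionalEquality using (_≡_)

-- Polynomials over ℚ as coefficient lists, lowest degree first
-- (trailing zeros allowed; equality is coefficientwise, see _≈ₚ_).
Poly : Set
Poly = List ℚ

coeff : Poly → ℕ → ℚ
coeff []       _       = 0ℚ
coeff (c ∷ _)  zero    = c
coeff (_ ∷ p)  (suc n) = coeff p n

_≈ₚ_ : Poly → Poly → Set
p ≈ₚ q = ∀ n → coeff p n ≡ coeff q n

_+ₚ_ : Poly → Poly → Poly
[]      +ₚ q       = q
(a ∷ p) +ₚ []      = a ∷ p
(a ∷ p) +ₚ (b ∷ q) = (a ℚ.+ b) ∷ (p +ₚ q)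

scale : ℚ → Poly → Poly
scale c = map (c ℚ.*_)

_*ₚ_ : Poly → Poly → Poly
[]      *ₚ q = []
(a ∷ p) *ₚ q = scale a q +ₚ (0ℚ ∷ (p *ₚ q))

_∘ₚ_ : Poly → Poly → Poly
[]      ∘ₚ g = []
(c ∷ f) ∘ₚ g = (c ∷ []) +ₚ (g *ₚ (f ∘ₚ g))

-- iterates: f^{∘0} = f, f^{∘(k+1)} = f ∘ f^{∘k}
iter : ℕ → Poly → Poly
iter zero    f = f
iter (suc k) f = f ∘ₚ iter k f

IsConstant : Poly → Set
IsConstant p = ∀ n → 1 ≤ n → coeff p n ≡ 0ℚ

-- irreducible over ℚ: nonconstant (nonzero non-unit) and every factorization
-- has a constant (necessarily nonzero, i.e. unit) factor
Irreducible : Poly → Set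
Irreducible p = ¬ IsConstant p × (∀ g h → p ≈ₚ (g *ₚ h) → IsConstant g ⊎ IsConstant h)

Reducible : Poly → Set
Reducible p = ¬ Irreducible p

EmergentReducibility : Poly → ℕ → Set
EmergentReducibility f n = (∀ i → i < n → Irreducible (iter i f)) × Reducible (iter n f)

ℤtoℚ : ℤ → ℚ
ℤtoℚ z = z / 1

fa : ℤ → Poly
fa a = map ℤtoℚ
  ( a
  ∷ (+ 4 ℤ.* a ℤ.- + 1)
  ∷ ℤ.- (+ 8 ℤ.* a ℤ.+ + 2)
  ∷ ℤ.- (+ 8 ℤ.* a)
  ∷ [])

{-# OPTIONS --safe #-}
-- f_a is a cubic, so it is irreducible as soon as it has no rational root. A root n/d in lowest
-- terms makes the homogenised cubic a d³ + (4a−1) n d² − (8a+2) n² d − 8a n³ vanish; modulo 3 this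
-- only depends on the residues of a, n and d, and running through the residues with 3 ∤ a and
-- (n, d) ≢ (0, 0) shows that it never vanishes.
-- For reducibility, f_a ∘ f_a = g_a · h_a with deg g_a = 3, deg h_a = 6 and leading coefficients
-- 32a² and 128a², which are nonzero since 3 ∤ a. The identity holds in ℤ[a][x], where it is
-- checked by computation, and is transported to ℚ[x] by evaluating the coefficients at a.
module Submission where

open import Defs
open import Data.Empty using (⊥-elim)
open import Data.Integer as ℤ using (ℤ; +_)
import Data.Integer.Properties as ℤ
open import Data.Integer.DivMod using (_%ℕ_; _/ℕ_; a≡a%ℕn+[a/ℕn]*n; n%ℕd<d)
open import Data.Integer.Divisibility using (_∣_)
open import Data.Integer.Tactic.RingSolver using (solve-∀)
open import Data.List using (List; []; _∷_; _++_; map; length; replicate)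
import Data.List.Properties as List
open import Data.List.Relation.Binary.Pointwise using (Pointwise; []; _∷_; Pointwise-length; Pointwise-≡⇒≡)
open import Data.Nat as ℕ using (ℕ; zero; suc; _<_; _≤_; z≤n; s≤s)
open import Data.Nat.Coprimality using (Coprime; recompute)
import Data.Nat.Divisibility as ℕ
import Data.Nat.Properties as ℕ
open import Data.Product using (∃; _×_; _,_)
open import Data.Rational as ℚ using (ℚ; 0ℚ; 1ℚ; ↥_; ↧_; ↧ₙ_)
import Data.Rational.Properties as ℚ
import Data.Rational.Unnormalised as ℚᵘ
import Data.Rational.Unnormalised.Properties as ℚᵘ
open import Data.Sum using (_⊎_; inj₁; inj₂; [_,_]′)
open import Function using (_∘_; id)
open import Level using (0ℓ)
open import Relation.Binary.PropositionalEquality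
open import Relation.Nullary using (¬_; yes; no; contradiction)
open import Relation.Nullary.Decidable using (False; toWitnessFalse; dec⇒maybe)
import Tactic.RingSolver as RingSolver
open import Tactic.RingSolver.Core.AlmostCommutativeRing using (AlmostCommutativeRing; fromCommutativeRing)

ℚ-ring : AlmostCommutativeRing 0ℓ 0ℓ
ℚ-ring = fromCommutativeRing ℚ.+-*-commutativeRing (λ x → dec⇒maybe (0ℚ ℚ.≟ x))

ℚ-no-zero-divisors : ∀ x y → x ℚ.* y ≡ 0ℚ → x ≡ 0ℚ ⊎ y ≡ 0ℚ
ℚ-no-zero-divisors x y xy≡0 with x ℚ.≟ 0ℚ
... | yes x≡0 = inj₁ x≡0
... | no x≢0 = inj₂ (begin
  y                     ≡⟨ sym (ℚ.*-identityˡ y) ⟩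
  1ℚ ℚ.* y              ≡⟨ cong (ℚ._* y) (sym (ℚ.*-inverseˡ x)) ⟩
  ℚ.1/ x ℚ.* x ℚ.* y    ≡⟨ ℚ.*-assoc (ℚ.1/ x) x y ⟩
  ℚ.1/ x ℚ.* (x ℚ.* y)  ≡⟨ cong (ℚ.1/ x ℚ.*_) xy≡0 ⟩
  ℚ.1/ x ℚ.* 0ℚ         ≡⟨ ℚ.*-zeroʳ (ℚ.1/ x) ⟩
  0ℚ                    ∎)
  where
  open ≡-Reasoning
  instance _ = ℚ.≢-nonZero x≢0

ℤtoℚ-toℚᵘ : ∀ i → ℚ.toℚᵘ (ℤtoℚ i) ℚᵘ.≃ ℚᵘ.mkℚᵘ i 0
ℤtoℚ-toℚᵘ i = ℚ.toℚᵘ-fromℚᵘ (ℚᵘ.mkℚᵘ i 0)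

ℤtoℚ-+ : ∀ i j → ℤtoℚ (i ℤ.+ j) ≡ ℤtoℚ i ℚ.+ ℤtoℚ j
ℤtoℚ-+ i j = ℚ.toℚᵘ-injective (ℚᵘ.≃-trans (ℤtoℚ-toℚᵘ (i ℤ.+ j)) (ℚᵘ.≃-sym (ℚᵘ.≃-trans
  (ℚ.toℚᵘ-homo-+ (ℤtoℚ i) (ℤtoℚ j))
  (ℚᵘ.≃-trans (ℚᵘ.+-cong (ℤtoℚ-toℚᵘ i) (ℤtoℚ-toℚᵘ j)) (ℚᵘ.*≡* (cross i j))))))
  where
  cross : ∀ i j → (i ℤ.* + 1 ℤ.+ j ℤ.* + 1) ℤ.* + 1 ≡ (i ℤ.+ j) ℤ.* + 1
  cross = solve-∀

ℤtoℚ-* : ∀ i j → ℤtoℚ (i ℤ.* j) ≡ ℤtoℚ i ℚ.* ℤtoℚ j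
ℤtoℚ-* i j = ℚ.toℚᵘ-injective (ℚᵘ.≃-trans (ℤtoℚ-toℚᵘ (i ℤ.* j)) (ℚᵘ.≃-sym (ℚᵘ.≃-trans
  (ℚ.toℚᵘ-homo-* (ℤtoℚ i) (ℤtoℚ j)) (ℚᵘ.*-cong (ℤtoℚ-toℚᵘ i) (ℤtoℚ-toℚᵘ j)))))

ℤtoℚ-injective : ∀ {i j} → ℤtoℚ i ≡ ℤtoℚ j → i ≡ j
ℤtoℚ-injective {i} {j} eq = begin
  i           ≡⟨ sym (ℤ.*-identityʳ i) ⟩
  i ℤ.* + 1   ≡⟨ ℚᵘ.drop-*≡* (ℚᵘ.≃-trans (ℚᵘ.≃-sym (ℤtoℚ-toℚᵘ i)) (ℚᵘ.≃-trans (ℚ.toℚᵘ-cong eq) (ℤtoℚ-toℚᵘ j))) ⟩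
  j ℤ.* + 1   ≡⟨ ℤ.*-identityʳ j ⟩
  j           ∎
  where open ≡-Reasoning

IsZero : Poly → Set
IsZero p = ∀ n → coeff p n ≡ 0ℚ

VanishesAbove : Poly → ℕ → Set
VanishesAbove p d = ∀ n → d < n → coeff p n ≡ 0ℚ

record HasDegree (p : Poly) (d : ℕ) : Set where
  constructor _,_
  field
    leading≢0 : coeff p d ≢ 0ℚ
    vanishes  : VanishesAbove p d

coeff-+ₚ : ∀ p q n → coeff (p +ₚ q) n ≡ coeff p n ℚ.+ coeff q n
coeff-+ₚ []      q       n       = sym (ℚ.+-identityˡ _)
coeff-+ₚ (a ∷ p) []      n       = sym (ℚ.+-identityʳ _)
coeff-+ₚ (a ∷ p) (b ∷ q) zero    = refl
coeff-+ₚ (a ∷ p) (b ∷ q) (suc n) = coeff-+ₚ p q n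

coeff-scale : ∀ c q n → coeff (scale c q) n ≡ c ℚ.* coeff q n
coeff-scale c []      n       = sym (ℚ.*-zeroʳ c)
coeff-scale c (b ∷ q) zero    = refl
coeff-scale c (b ∷ q) (suc n) = coeff-scale c q n

coeff-*ₚ-zero : ∀ a p q → coeff ((a ∷ p) *ₚ q) zero ≡ a ℚ.* coeff q zero
coeff-*ₚ-zero a p q = begin
  coeff (scale a q +ₚ (0ℚ ∷ (p *ₚ q))) zero  ≡⟨ coeff-+ₚ (scale a q) _ zero ⟩
  coeff (scale a q) zero ℚ.+ 0ℚ             ≡⟨ ℚ.+-identityʳ _ ⟩
  coeff (scale a q) zero                    ≡⟨ coeff-scale a q zero ⟩
  a ℚ.* coeff q zero                        ∎
  where open ≡-Reasoning

coeff-*ₚ-suc : ∀ a p q n → coeff ((a ∷ p) *ₚ q) (suc n) ≡ a ℚ.* coeff q (suc n) ℚ.+ coeff (p *ₚ q) n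
coeff-*ₚ-suc a p q n = trans (coeff-+ₚ (scale a q) (0ℚ ∷ (p *ₚ q)) (suc n))
  (cong (ℚ._+ coeff (p *ₚ q) n) (coeff-scale a q (suc n)))

*ₚ-zeroˡ : ∀ g h → IsZero g → IsZero (g *ₚ h)
*ₚ-zeroˡ []      h g≡0 n       = refl
*ₚ-zeroˡ (a ∷ p) h g≡0 zero    = begin
  coeff ((a ∷ p) *ₚ h) zero  ≡⟨ coeff-*ₚ-zero a p h ⟩
  a ℚ.* coeff h zero         ≡⟨ cong (ℚ._* coeff h zero) (g≡0 zero) ⟩
  0ℚ ℚ.* coeff h zero        ≡⟨ ℚ.*-zeroˡ (coeff h zero) ⟩
  0ℚ                         ∎
  where open ≡-Reasoning
*ₚ-zeroˡ (a ∷ p) h g≡0 (suc n) = begin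
  coeff ((a ∷ p) *ₚ h) (suc n)               ≡⟨ coeff-*ₚ-suc a p h n ⟩
  a ℚ.* coeff h (suc n) ℚ.+ coeff (p *ₚ h) n ≡⟨ cong₂ (λ x y → x ℚ.* coeff h (suc n) ℚ.+ y) (g≡0 zero) (*ₚ-zeroˡ p h (g≡0 ∘ suc) n) ⟩
  0ℚ ℚ.* coeff h (suc n) ℚ.+ 0ℚ              ≡⟨ cong (ℚ._+ 0ℚ) (ℚ.*-zeroˡ (coeff h (suc n))) ⟩
  0ℚ                                         ∎
  where open ≡-Reasoning

vanishesAbove-*ₚ : ∀ g d h e → VanishesAbove g d → VanishesAbove h e → VanishesAbove (g *ₚ h) (d ℕ.+ e)
vanishesAbove-*ₚ []      d h e _  _  n       _       = refl
vanishesAbove-*ₚ (a ∷ p) d h e _  _  zero    ()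
vanishesAbove-*ₚ (a ∷ p) d h e vg vh (suc n) d+e<1+n = begin
  coeff ((a ∷ p) *ₚ h) (suc n)               ≡⟨ coeff-*ₚ-suc a p h n ⟩
  a ℚ.* coeff h (suc n) ℚ.+ coeff (p *ₚ h) n ≡⟨ cong₂ (λ x y → a ℚ.* x ℚ.+ y) (vh (suc n) e<1+n) (tail-vanishes d vg d+e<1+n) ⟩
  a ℚ.* 0ℚ ℚ.+ 0ℚ                            ≡⟨ cong (ℚ._+ 0ℚ) (ℚ.*-zeroʳ a) ⟩
  0ℚ                                         ∎
  where
  open ≡-Reasoning
  e<1+n : e < suc n
  e<1+n = ℕ.≤-trans (s≤s (ℕ.m≤n+m e d)) d+e<1+n
  tail-vanishes : ∀ d → VanishesAbove (a ∷ p) d → d ℕ.+ e < suc n → coeff (p *ₚ h) n ≡ 0ℚ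
  tail-vanishes zero    vg _           = *ₚ-zeroˡ p h (λ m → vg (suc m) (s≤s z≤n)) n
  tail-vanishes (suc d) vg (s≤s d+e<n) = vanishesAbove-*ₚ p d h e (λ m d<m → vg (suc m) (s≤s d<m)) vh n d+e<n

leading-*ₚ : ∀ g d h e → VanishesAbove g d → VanishesAbove h e → coeff (g *ₚ h) (d ℕ.+ e) ≡ coeff g d ℚ.* coeff h e
leading-*ₚ []      d       h e       _  _  = sym (ℚ.*-zeroˡ (coeff h e))
leading-*ₚ (a ∷ p) zero    h zero    _  _  = coeff-*ₚ-zero a p h
leading-*ₚ (a ∷ p) zero    h (suc e) vg _  = begin
  coeff ((a ∷ p) *ₚ h) (suc e)               ≡⟨ coeff-*ₚ-suc a p h e ⟩
  a ℚ.* coeff h (suc e) ℚ.+ coeff (p *ₚ h) e ≡⟨ cong (a ℚ.* coeff h (suc e) ℚ.+_) (*ₚ-zeroˡ p h (λ m → vg (suc m) (s≤s z≤n)) e) ⟩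
  a ℚ.* coeff h (suc e) ℚ.+ 0ℚ               ≡⟨ ℚ.+-identityʳ _ ⟩
  a ℚ.* coeff h (suc e)                      ∎
  where open ≡-Reasoning
leading-*ₚ (a ∷ p) (suc d) h e       vg vh = begin
  coeff ((a ∷ p) *ₚ h) (suc d ℕ.+ e)                         ≡⟨ coeff-*ₚ-suc a p h (d ℕ.+ e) ⟩
  a ℚ.* coeff h (suc (d ℕ.+ e)) ℚ.+ coeff (p *ₚ h) (d ℕ.+ e) ≡⟨ cong₂ (λ x y → a ℚ.* x ℚ.+ y) (vh _ (s≤s (ℕ.m≤n+m e d))) (leading-*ₚ p d h e (λ m d<m → vg (suc m) (s≤s d<m)) vh) ⟩
  a ℚ.* 0ℚ ℚ.+ coeff p d ℚ.* coeff h e                       ≡⟨ cong (ℚ._+ coeff p d ℚ.* coeff h e) (ℚ.*-zeroʳ a) ⟩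
  0ℚ ℚ.+ coeff p d ℚ.* coeff h e                             ≡⟨ ℚ.+-identityˡ _ ⟩
  coeff p d ℚ.* coeff h e                                    ∎
  where open ≡-Reasoning

degree-*ₚ : ∀ {g d h e} → HasDegree g d → HasDegree h e → HasDegree (g *ₚ h) (d ℕ.+ e)
degree-*ₚ {g} {d} {h} {e} (g≢0 , vg) (h≢0 , vh) =
  (λ gh≡0 → [ g≢0 , h≢0 ]′ (ℚ-no-zero-divisors _ _ (trans (sym (leading-*ₚ g d h e vg vh)) gh≡0))) ,
  vanishesAbove-*ₚ g d h e vg vh

degree? : ∀ p → IsZero p ⊎ ∃ (HasDegree p)
degree? [] = inj₁ λ _ → refl
degree? (a ∷ p) with degree? p
... | inj₂ (d , p≢0 , vp) = inj₂ (suc d , p≢0 , λ { zero () ; (suc n) (s≤s d<n) → vp n d<n })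
... | inj₁ p≡0 with a ℚ.≟ 0ℚ
...   | yes a≡0 = inj₁ λ { zero → a≡0 ; (suc n) → p≡0 n }
...   | no a≢0  = inj₂ (zero , a≢0 , λ { zero () ; (suc n) _ → p≡0 n })

degree-bound : ∀ {p d n} → HasDegree p d → coeff p n ≢ 0ℚ → n ℕ.≤ d
degree-bound {n = n} (_ , vp) pn≢0 with n ℕ.≤? _
... | yes n≤d = n≤d
... | no n≰d  = ⊥-elim (pn≢0 (vp n (ℕ.≰⇒> n≰d)))

eval : Poly → ℚ → ℚ
eval []      x = 0ℚ
eval (c ∷ p) x = c ℚ.+ x ℚ.* eval p x

eval-+ₚ : ∀ p q x → eval (p +ₚ q) x ≡ eval p x ℚ.+ eval q x
eval-+ₚ []      q       x = sym (ℚ.+-identityˡ _)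
eval-+ₚ (a ∷ p) []      x = sym (ℚ.+-identityʳ _)
eval-+ₚ (a ∷ p) (b ∷ q) x = trans (cong (λ t → a ℚ.+ b ℚ.+ x ℚ.* t) (eval-+ₚ p q x)) (regroup a b x _ _)
  where
  regroup : ∀ a b x s t → a ℚ.+ b ℚ.+ x ℚ.* (s ℚ.+ t) ≡ a ℚ.+ x ℚ.* s ℚ.+ (b ℚ.+ x ℚ.* t)
  regroup = RingSolver.solve-∀ ℚ-ring

eval-scale : ∀ c q x → eval (scale c q) x ≡ c ℚ.* eval q x
eval-scale c []      x = sym (ℚ.*-zeroʳ c)
eval-scale c (b ∷ q) x = trans (cong (λ t → c ℚ.* b ℚ.+ x ℚ.* t) (eval-scale c q x)) (regroup c b x _)
  where
  regroup : ∀ c b x t → c ℚ.* b ℚ.+ x ℚ.* (c ℚ.* t) ≡ c ℚ.* (b ℚ.+ x ℚ.* t)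
  regroup = RingSolver.solve-∀ ℚ-ring

eval-*ₚ : ∀ g h x → eval (g *ₚ h) x ≡ eval g x ℚ.* eval h x
eval-*ₚ []      h x = sym (ℚ.*-zeroˡ (eval h x))
eval-*ₚ (a ∷ p) h x = begin
  eval (scale a h +ₚ (0ℚ ∷ (p *ₚ h))) x                 ≡⟨ eval-+ₚ (scale a h) _ x ⟩
  eval (scale a h) x ℚ.+ (0ℚ ℚ.+ x ℚ.* eval (p *ₚ h) x) ≡⟨ cong₂ (λ s t → s ℚ.+ (0ℚ ℚ.+ x ℚ.* t)) (eval-scale a h x) (eval-*ₚ p h x) ⟩
  a ℚ.* eval h x ℚ.+ (0ℚ ℚ.+ x ℚ.* (eval p x ℚ.* eval h x)) ≡⟨ regroup a x _ _ ⟩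
  (a ℚ.+ x ℚ.* eval p x) ℚ.* eval h x                   ∎
  where
  open ≡-Reasoning
  regroup : ∀ a x s t → a ℚ.* t ℚ.+ (0ℚ ℚ.+ x ℚ.* (s ℚ.* t)) ≡ (a ℚ.+ x ℚ.* s) ℚ.* t
  regroup = RingSolver.solve-∀ ℚ-ring

eval-zero : ∀ p x → IsZero p → eval p x ≡ 0ℚ
eval-zero []      x _   = refl
eval-zero (a ∷ p) x p≡0 = begin
  a ℚ.+ x ℚ.* eval p x ≡⟨ cong₂ (λ s t → s ℚ.+ x ℚ.* t) (p≡0 zero) (eval-zero p x (p≡0 ∘ suc)) ⟩
  0ℚ ℚ.+ x ℚ.* 0ℚ      ≡⟨ cong (0ℚ ℚ.+_) (ℚ.*-zeroʳ x) ⟩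
  0ℚ                   ∎
  where open ≡-Reasoning

eval-cong : ∀ p q x → p ≈ₚ q → eval p x ≡ eval q x
eval-cong []      q       x p≈q = sym (eval-zero q x (sym ∘ p≈q))
eval-cong (a ∷ p) []      x p≈q = eval-zero (a ∷ p) x p≈q
eval-cong (a ∷ p) (b ∷ q) x p≈q = cong₂ (λ s t → s ℚ.+ x ℚ.* t) (p≈q zero) (eval-cong p q x (p≈q ∘ suc))

linear-root : ∀ {p} → HasDegree p 1 → ∃ λ r → eval p r ≡ 0ℚ
linear-root {p} (p₁≢0 , vp) = r , (begin
  eval p r                                   ≡⟨ eval-cong p (p₀ ∷ p₁ ∷ []) r linear-form ⟩
  p₀ ℚ.+ r ℚ.* (p₁ ℚ.+ r ℚ.* 0ℚ)             ≡⟨ solve-root p₀ p₁ (ℚ.1/ p₁) ⟩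
  p₀ ℚ.- p₀ ℚ.* (p₁ ℚ.* ℚ.1/ p₁)             ≡⟨ cong (λ t → p₀ ℚ.- p₀ ℚ.* t) (ℚ.*-inverseʳ p₁) ⟩
  p₀ ℚ.- p₀ ℚ.* 1ℚ                           ≡⟨ cancel p₀ ⟩
  0ℚ                                         ∎)
  where
  open ≡-Reasoning
  p₀ = coeff p 0
  p₁ = coeff p 1
  instance _ = ℚ.≢-nonZero p₁≢0
  r = ℚ.- (p₀ ℚ.* ℚ.1/ p₁)
  linear-form : p ≈ₚ (p₀ ∷ p₁ ∷ [])
  linear-form zero          = refl
  linear-form (suc zero)    = refl
  linear-form (suc (suc n)) = vp (suc (suc n)) (s≤s (s≤s z≤n))
  solve-root : ∀ a b c → a ℚ.+ ℚ.- (a ℚ.* c) ℚ.* (b ℚ.+ ℚ.- (a ℚ.* c) ℚ.* 0ℚ) ≡ a ℚ.- a ℚ.* (b ℚ.* c)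
  solve-root = RingSolver.solve-∀ ℚ-ring
  cancel : ∀ a → a ℚ.- a ℚ.* 1ℚ ≡ 0ℚ
  cancel = RingSolver.solve-∀ ℚ-ring

eval-factor-root : ∀ f g h r → f ≈ₚ (g *ₚ h) → eval g r ≡ 0ℚ ⊎ eval h r ≡ 0ℚ → eval f r ≡ 0ℚ
eval-factor-root f g h r f≈gh root = begin
  eval f r                  ≡⟨ eval-cong f (g *ₚ h) r f≈gh ⟩
  eval (g *ₚ h) r           ≡⟨ eval-*ₚ g h r ⟩
  eval g r ℚ.* eval h r     ≡⟨ [ (λ gr≡0 → trans (cong (ℚ._* eval h r) gr≡0) (ℚ.*-zeroˡ (eval h r)))
                               , (λ hr≡0 → trans (cong (eval g r ℚ.*_) hr≡0) (ℚ.*-zeroʳ (eval g r))) ]′ root ⟩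
  0ℚ                        ∎
  where open ≡-Reasoning

linear-factor⇒root : ∀ f g h → f ≈ₚ (g *ₚ h) → HasDegree g 1 ⊎ HasDegree h 1 → ∃ λ r → eval f r ≡ 0ℚ
linear-factor⇒root f g h f≈gh (inj₁ g-deg) = let (r , gr≡0) = linear-root g-deg in r , eval-factor-root f g h r f≈gh (inj₁ gr≡0)
linear-factor⇒root f g h f≈gh (inj₂ h-deg) = let (r , hr≡0) = linear-root h-deg in r , eval-factor-root f g h r f≈gh (inj₂ hr≡0)

rootless⇒irreducible : ∀ {f d} → HasDegree f d → 1 ≤ d → d ≤ 3 → (∀ r → eval f r ≢ 0ℚ) → Irreducible f
rootless⇒irreducible {f} {d} f-deg@(f≢0 , _) 1≤d d≤3 rootless = (λ f-const → f≢0 (f-const d 1≤d)) , factors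
  where
  no-linear-factor : ∀ g h → f ≈ₚ (g *ₚ h) → ¬ (HasDegree g 1 ⊎ HasDegree h 1)
  no-linear-factor g h f≈gh linear = let (r , fr≡0) = linear-factor⇒root f g h f≈gh linear in rootless r fr≡0
  factors : ∀ g h → f ≈ₚ (g *ₚ h) → IsConstant g ⊎ IsConstant h
  factors g h f≈gh with degree? g | degree? h
  ... | inj₁ g≡0           | _                  = inj₁ λ n _ → g≡0 n
  ... | inj₂ _             | inj₁ h≡0           = inj₂ λ n _ → h≡0 n
  ... | inj₂ (0 , _ , vg)  | _                  = inj₁ vg
  ... | inj₂ _             | inj₂ (0 , _ , vh)  = inj₂ vh
  ... | inj₂ (1 , g-deg)   | _                  = ⊥-elim (no-linear-factor g h f≈gh (inj₁ g-deg))
  ... | inj₂ _             | inj₂ (1 , h-deg)   = ⊥-elim (no-linear-factor g h f≈gh (inj₂ h-deg))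
  ... | inj₂ (suc (suc dg) , g-deg) | inj₂ (suc (suc dh) , h-deg) = ⊥-elim (ℕ.<-irrefl refl (begin-strict
    3                               <⟨ s≤s (s≤s (ℕ.≤-trans (s≤s (s≤s z≤n)) (ℕ.m≤n+m (2 ℕ.+ dh) dg))) ⟩
    suc (suc dg) ℕ.+ suc (suc dh)   ≤⟨ degree-bound f-deg (λ f≡0 → HasDegree.leading≢0 (degree-*ₚ g-deg h-deg) (trans (sym (f≈gh _)) f≡0)) ⟩
    d                               ≤⟨ d≤3 ⟩
    3                               ∎))
    where open ℕ.≤-Reasoning

-- Rational roots of integer polynomials

homogenise : List ℤ → ℤ → ℤ → ℤ
homogenise []       n d = + 0
homogenise (c ∷ cs) n d = c ℤ.* d ℤ.^ length cs ℤ.+ n ℤ.* homogenise cs n d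

homogenise-eval : ∀ cs n d r → r ℚ.* ℤtoℚ d ≡ ℤtoℚ n →
                  ℤtoℚ (homogenise cs n d) ℚ.* ℤtoℚ d ≡ ℤtoℚ (d ℤ.^ length cs) ℚ.* eval (map ℤtoℚ cs) r
homogenise-eval []       n d r _   = trans (ℚ.*-zeroˡ (ℤtoℚ d)) (sym (ℚ.*-zeroʳ 1ℚ))
homogenise-eval (c ∷ cs) n d r r·d≡n = begin
  ℤtoℚ (c ℤ.* dᵏ ℤ.+ n ℤ.* H) ℚ.* D                 ≡⟨ cong (ℚ._* D) (trans (ℤtoℚ-+ (c ℤ.* dᵏ) (n ℤ.* H)) (cong₂ ℚ._+_ (ℤtoℚ-* c dᵏ) (ℤtoℚ-* n H))) ⟩
  (C ℚ.* Dᵏ ℚ.+ ℤtoℚ n ℚ.* ℤtoℚ H) ℚ.* D           ≡⟨ cong (λ t → (C ℚ.* Dᵏ ℚ.+ t ℚ.* ℤtoℚ H) ℚ.* D) (sym r·d≡n) ⟩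
  (C ℚ.* Dᵏ ℚ.+ r ℚ.* D ℚ.* ℤtoℚ H) ℚ.* D          ≡⟨ expand C Dᵏ D r (ℤtoℚ H) ⟩
  C ℚ.* Dᵏ ℚ.* D ℚ.+ r ℚ.* D ℚ.* (ℤtoℚ H ℚ.* D)   ≡⟨ cong (λ t → C ℚ.* Dᵏ ℚ.* D ℚ.+ r ℚ.* D ℚ.* t) (homogenise-eval cs n d r r·d≡n) ⟩
  C ℚ.* Dᵏ ℚ.* D ℚ.+ r ℚ.* D ℚ.* (Dᵏ ℚ.* E)        ≡⟨ factor C Dᵏ D r E ⟩
  D ℚ.* Dᵏ ℚ.* (C ℚ.+ r ℚ.* E)                     ≡⟨ cong (ℚ._* (C ℚ.+ r ℚ.* E)) (sym (ℤtoℚ-* d dᵏ)) ⟩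
  ℤtoℚ (d ℤ.* dᵏ) ℚ.* (C ℚ.+ r ℚ.* E)              ∎
  where
  open ≡-Reasoning
  dᵏ = d ℤ.^ length cs
  H  = homogenise cs n d
  C  = ℤtoℚ c
  D  = ℤtoℚ d
  Dᵏ = ℤtoℚ dᵏ
  E  = eval (map ℤtoℚ cs) r
  expand : ∀ c p d r h → (c ℚ.* p ℚ.+ r ℚ.* d ℚ.* h) ℚ.* d ≡ c ℚ.* p ℚ.* d ℚ.+ r ℚ.* d ℚ.* (h ℚ.* d)
  expand = RingSolver.solve-∀ ℚ-ring
  factor : ∀ c p d r e → c ℚ.* p ℚ.* d ℚ.+ r ℚ.* d ℚ.* (p ℚ.* e) ≡ d ℚ.* p ℚ.* (c ℚ.+ r ℚ.* e)
  factor = RingSolver.solve-∀ ℚ-ring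

numerator-denominator : ∀ r → r ℚ.* ℤtoℚ (↧ r) ≡ ℤtoℚ (↥ r)
numerator-denominator r = begin
  r ℚ.* ℤtoℚ (↧ r)                   ≡⟨ cong (ℚ._* ℤtoℚ (↧ r)) (sym (ℚ.↥p/↧p≡p r)) ⟩
  (↥ r ℚ./ ↧ₙ r) ℚ.* ℤtoℚ (↧ r)      ≡⟨ ℚ.toℚᵘ-injective (ℚᵘ.≃-trans (ℚ.toℚᵘ-homo-* (↥ r ℚ./ ↧ₙ r) (ℤtoℚ (↧ r)))
                                         (ℚᵘ.≃-trans (ℚᵘ.*-cong (ℚ.toℚᵘ-fromℚᵘ (ℚᵘ.mkℚᵘ (↥ r) k)) (ℤtoℚ-toℚᵘ (↧ r)))
                                         (ℚᵘ.≃-trans (ℚᵘ.*≡* (cross (↥ r))) (ℚᵘ.≃-sym (ℤtoℚ-toℚᵘ (↥ r)))))) ⟩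
  ℤtoℚ (↥ r)                         ∎
  where
  open ≡-Reasoning
  k = ℚ.denominator-1 r
  cross : ∀ n → n ℤ.* + suc k ℤ.* + 1 ≡ n ℤ.* + suc (k ℕ.* 1)
  cross n rewrite ℕ.*-identityʳ k = ℤ.*-identityʳ (n ℤ.* + suc k)

rational-root⇒homogeneous-root : ∀ cs r → eval (map ℤtoℚ cs) r ≡ 0ℚ → homogenise cs (↥ r) (↧ r) ≡ + 0
rational-root⇒homogeneous-root cs r root =
  [ ℤtoℚ-injective , (λ D≡0 → contradiction (ℤtoℚ-injective {↧ r} {+ 0} D≡0) λ ()) ]′ (ℚ-no-zero-divisors _ _ cleared)
  where
  cleared : ℤtoℚ (homogenise cs (↥ r) (↧ r)) ℚ.* ℤtoℚ (↧ r) ≡ 0ℚ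
  cleared = trans (homogenise-eval cs (↥ r) (↧ r) r (numerator-denominator r))
                  (trans (cong (ℤtoℚ (↧ r ℤ.^ length cs) ℚ.*_) root) (ℚ.*-zeroʳ (ℤtoℚ (↧ r ℤ.^ length cs))))

-- Congruences of integers

infix 4 _≡_mod_
record _≡_mod_ (i j : ℤ) (m : ℕ) : Set where
  constructor congruent
  field
    quotient : ℤ
    equation : i ≡ j ℤ.+ + m ℤ.* quotient

module _ {m : ℕ} where

  mod-refl : ∀ {i} → i ≡ i mod m
  mod-refl {i} = congruent (+ 0) (shift (+ m) i)
    where
    shift : ∀ M i → i ≡ i ℤ.+ M ℤ.* + 0
    shift = solve-∀

  mod-sym : ∀ {i j} → i ≡ j mod m → j ≡ i mod m
  mod-sym {j = j} (congruent q refl) = congruent (ℤ.- q) (shift (+ m) j q)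
    where
    shift : ∀ M j q → j ≡ j ℤ.+ M ℤ.* q ℤ.+ M ℤ.* ℤ.- q
    shift = solve-∀

  mod-trans : ∀ {i j k} → i ≡ j mod m → j ≡ k mod m → i ≡ k mod m
  mod-trans {k = k} (congruent q refl) (congruent q′ refl) = congruent (q′ ℤ.+ q) (shift (+ m) k q q′)
    where
    shift : ∀ M k q q′ → k ℤ.+ M ℤ.* q′ ℤ.+ M ℤ.* q ≡ k ℤ.+ M ℤ.* (q′ ℤ.+ q)
    shift = solve-∀

  +-cong-mod : ∀ {i i′ j j′} → i ≡ i′ mod m → j ≡ j′ mod m → i ℤ.+ j ≡ i′ ℤ.+ j′ mod m
  +-cong-mod {i′ = i′} {j′ = j′} (congruent q refl) (congruent q′ refl) = congruent (q ℤ.+ q′) (shift (+ m) i′ j′ q q′)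
    where
    shift : ∀ M i j q q′ → i ℤ.+ M ℤ.* q ℤ.+ (j ℤ.+ M ℤ.* q′) ≡ i ℤ.+ j ℤ.+ M ℤ.* (q ℤ.+ q′)
    shift = solve-∀

  *-cong-mod : ∀ {i i′ j j′} → i ≡ i′ mod m → j ≡ j′ mod m → i ℤ.* j ≡ i′ ℤ.* j′ mod m
  *-cong-mod {i′ = i′} {j′ = j′} (congruent q refl) (congruent q′ refl) =
    congruent (q ℤ.* j′ ℤ.+ i′ ℤ.* q′ ℤ.+ + m ℤ.* q ℤ.* q′) (shift (+ m) i′ j′ q q′)
    where
    shift : ∀ M i j q q′ → (i ℤ.+ M ℤ.* q) ℤ.* (j ℤ.+ M ℤ.* q′) ≡ i ℤ.* j ℤ.+ M ℤ.* (q ℤ.* j ℤ.+ i ℤ.* q′ ℤ.+ M ℤ.* q ℤ.* q′)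
    shift = solve-∀

  -‿cong-mod : ∀ {i i′} → i ≡ i′ mod m → ℤ.- i ≡ ℤ.- i′ mod m
  -‿cong-mod {i′ = i′} (congruent q refl) = congruent (ℤ.- q) (shift (+ m) i′ q)
    where
    shift : ∀ M i q → ℤ.- (i ℤ.+ M ℤ.* q) ≡ ℤ.- i ℤ.+ M ℤ.* ℤ.- q
    shift = solve-∀

  ^-cong-mod : ∀ {i i′} → i ≡ i′ mod m → ∀ k → i ℤ.^ k ≡ i′ ℤ.^ k mod m
  ^-cong-mod i≡i′ zero    = mod-refl
  ^-cong-mod i≡i′ (suc k) = *-cong-mod i≡i′ (^-cong-mod i≡i′ k)

  homogenise-cong-mod : ∀ {cs cs′ n n′ d d′} → Pointwise (λ c c′ → c ≡ c′ mod m) cs cs′ →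
                        n ≡ n′ mod m → d ≡ d′ mod m → homogenise cs n d ≡ homogenise cs′ n′ d′ mod m
  homogenise-cong-mod []                          n≡n′ d≡d′ = mod-refl
  homogenise-cong-mod {c ∷ cs} {d = d} {d′} (c≡c′ ∷ cs≡cs′) n≡n′ d≡d′ = +-cong-mod
    (*-cong-mod c≡c′ (subst (λ k → d ℤ.^ length cs ≡ d′ ℤ.^ k mod m) (Pointwise-length cs≡cs′) (^-cong-mod d≡d′ (length cs))))
    (*-cong-mod n≡n′ (homogenise-cong-mod cs≡cs′ n≡n′ d≡d′))

  mod-residue : .{{_ : ℕ.NonZero m}} → ∀ i → i ≡ + (i %ℕ m) mod m
  mod-residue i = congruent (i /ℕ m) (trans (a≡a%ℕn+[a/ℕn]*n i m) (cong (ℤ._+_ (+ (i %ℕ m))) (ℤ.*-comm (i /ℕ m) (+ m))))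

  mod-zero⇒∣ : ∀ {i} → i ≡ + 0 mod m → + m ∣ i
  mod-zero⇒∣ (congruent q refl) = ℕ.divides ℤ.∣ q ∣ (trans (cong ℤ.∣_∣ (ℤ.+-identityˡ (+ m ℤ.* q))) (trans (ℤ.abs-* (+ m) q) (ℕ.*-comm m ℤ.∣ q ∣)))

numerator-denominator-coprime : ∀ r → Coprime ℤ.∣ ↥ r ∣ (↧ₙ r)
numerator-denominator-coprime (ℚ.mkℚ _ _ coprime) = recompute coprime

3∤⇒≢0 : ∀ a → ¬ + 3 ∣ a → a ≢ + 0
3∤⇒≢0 _ 3∤a refl = 3∤a (3 ℕ.∣0)

fa-coefficients : ℤ → List ℤ
fa-coefficients a = a ∷ (+ 4 ℤ.* a ℤ.- + 1) ∷ ℤ.- (+ 8 ℤ.* a ℤ.+ + 2) ∷ ℤ.- (+ 8 ℤ.* a) ∷ []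

fa-coefficients-cong : ∀ {m a a′} → a ≡ a′ mod m → Pointwise (λ c c′ → c ≡ c′ mod m) (fa-coefficients a) (fa-coefficients a′)
fa-coefficients-cong a≡a′ =
  a≡a′ ∷
  +-cong-mod (*-cong-mod (mod-refl {i = + 4}) a≡a′) (mod-refl {i = ℤ.- + 1}) ∷
  -‿cong-mod (+-cong-mod (*-cong-mod (mod-refl {i = + 8}) a≡a′) (mod-refl {i = + 2})) ∷
  -‿cong-mod (*-cong-mod (mod-refl {i = + 8}) a≡a′) ∷ []

homogenised-fa≢0 : ∀ a n d → ¬ + 3 ∣ a → ¬ (+ 3 ∣ n × + 3 ∣ d) → homogenise (fa-coefficients a) n d ≢ + 0
homogenised-fa≢0 a n d 3∤a 3∤n,d H≡0 = toWitnessFalse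
  (table (a %ℕ 3) (n %ℕ 3) (d %ℕ 3) (n%ℕd<d a 3) (n%ℕd<d n 3) (n%ℕd<d d 3)
         (λ s≡0 → 3∤a (residue-zero⇒∣ a s≡0))
         (λ (v≡0 , t≡0) → 3∤n,d (residue-zero⇒∣ n v≡0 , residue-zero⇒∣ d t≡0)))
  (mod-zero⇒∣ (mod-trans (mod-sym reduce) (subst (_≡ + 0 mod 3) (sym H≡0) mod-refl)))
  where
  residue-zero⇒∣ : ∀ i → i %ℕ 3 ≡ 0 → + 3 ∣ i
  residue-zero⇒∣ i i%3≡0 = mod-zero⇒∣ (subst (λ s → i ≡ + s mod 3) i%3≡0 (mod-residue i))
  reduce : homogenise (fa-coefficients a) n d ≡ homogenise (fa-coefficients (+ (a %ℕ 3))) (+ (n %ℕ 3)) (+ (d %ℕ 3)) mod 3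
  reduce = homogenise-cong-mod (fa-coefficients-cong (mod-residue a)) (mod-residue n) (mod-residue d)
  table : ∀ s v t → s < 3 → v < 3 → t < 3 → s ≢ 0 → ¬ (v ≡ 0 × t ≡ 0) →
          False (3 ℕ.∣? ℤ.∣ homogenise (fa-coefficients (+ s)) (+ v) (+ t) ∣)
  table 0 _ _ _ _ _ s≢0 _     = contradiction refl s≢0
  table _ 0 0 _ _ _ _   v,t≢0 = contradiction (refl , refl) v,t≢0
  table 1 0 1 _ _ _ _ _ = _
  table 1 0 2 _ _ _ _ _ = _
  table 1 1 0 _ _ _ _ _ = _
  table 1 1 1 _ _ _ _ _ = _
  table 1 1 2 _ _ _ _ _ = _
  table 1 2 0 _ _ _ _ _ = _
  table 1 2 1 _ _ _ _ _ = _
  table 1 2 2 _ _ _ _ _ = _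
  table 2 0 1 _ _ _ _ _ = _
  table 2 0 2 _ _ _ _ _ = _
  table 2 1 0 _ _ _ _ _ = _
  table 2 1 1 _ _ _ _ _ = _
  table 2 1 2 _ _ _ _ _ = _
  table 2 2 0 _ _ _ _ _ = _
  table 2 2 1 _ _ _ _ _ = _
  table 2 2 2 _ _ _ _ _ = _
  table (suc (suc (suc _))) _ _ (s≤s (s≤s (s≤s ()))) _ _ _ _
  table _ (suc (suc (suc _))) _ _ (s≤s (s≤s (s≤s ()))) _ _ _
  table _ _ (suc (suc (suc _))) _ _ (s≤s (s≤s (s≤s ()))) _ _

fa-rootless : ∀ a → ¬ + 3 ∣ a → ∀ r → eval (fa a) r ≢ 0ℚ
fa-rootless a 3∤a r root = homogenised-fa≢0 a (↥ r) (↧ r) 3∤a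
  (λ 3∣↥,↧ → contradiction (numerator-denominator-coprime r 3∣↥,↧) λ ())
  (rational-root⇒homogeneous-root (fa-coefficients a) r root)

fa-degree : ∀ {a} → a ≢ + 0 → HasDegree (fa a) 3
fa-degree {a} a≢0 = leading≢0 , vanishes
  where
  leading≢0 : ℤtoℚ (ℤ.- (+ 8 ℤ.* a)) ≢ 0ℚ
  leading≢0 eq = a≢0 ([ (λ ()) , id ]′ (ℤ.i*j≡0⇒i≡0∨j≡0 (+ 8) (ℤ.neg-injective (ℤtoℚ-injective {j = + 0} eq))))
  vanishes : VanishesAbove (fa a) 3
  vanishes 0 ()
  vanishes 1 (s≤s ())
  vanishes 2 (s≤s (s≤s ()))
  vanishes 3 (s≤s (s≤s (s≤s ())))
  vanishes (suc (suc (suc (suc n)))) _ = refl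

fa-irreducible : ∀ a → ¬ + 3 ∣ a → Irreducible (fa a)
fa-irreducible a 3∤a = rootless⇒irreducible (fa-degree (3∤⇒≢0 a 3∤a)) (s≤s z≤n) ℕ.≤-refl (fa-rootless a 3∤a)

-- Polynomials with coefficients in ℤ[a]

module CoefficientLists {A : Set} (0# : A) (_+_ _*_ : A → A → A) where

  infixl 6 _⊕_
  infixl 7 _⊛_

  _⊕_ : List A → List A → List A
  []      ⊕ q       = q
  (a ∷ p) ⊕ []      = a ∷ p
  (a ∷ p) ⊕ (b ∷ q) = (a + b) ∷ (p ⊕ q)

  _⊛_ : List A → List A → List A
  []      ⊛ q = []
  (a ∷ p) ⊛ q = map (a *_) q ⊕ (0# ∷ (p ⊛ q))

  _⊚_ : List A → List A → List A
  []      ⊚ g = []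
  (c ∷ f) ⊚ g = (c ∷ []) ⊕ (g ⊛ (f ⊚ g))

  module Homomorphism (φ : A → ℚ) (φ-0# : φ 0# ≡ 0ℚ)
                      (φ-+ : ∀ x y → φ (x + y) ≡ φ x ℚ.+ φ y)
                      (φ-* : ∀ x y → φ (x * y) ≡ φ x ℚ.* φ y) where

    map-⊕ : ∀ p q → map φ (p ⊕ q) ≡ map φ p +ₚ map φ q
    map-⊕ []      q       = refl
    map-⊕ (a ∷ p) []      = refl
    map-⊕ (a ∷ p) (b ∷ q) = cong₂ _∷_ (φ-+ a b) (map-⊕ p q)

    map-scale : ∀ c q → map φ (map (c *_) q) ≡ scale (φ c) (map φ q)
    map-scale c []      = refl
    map-scale c (b ∷ q) = cong₂ _∷_ (φ-* c b) (map-scale c q)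

    map-⊛ : ∀ p q → map φ (p ⊛ q) ≡ map φ p *ₚ map φ q
    map-⊛ []      q = refl
    map-⊛ (a ∷ p) q = begin
      map φ (map (a *_) q ⊕ (0# ∷ (p ⊛ q)))              ≡⟨ map-⊕ (map (a *_) q) (0# ∷ (p ⊛ q)) ⟩
      map φ (map (a *_) q) +ₚ (φ 0# ∷ map φ (p ⊛ q))     ≡⟨ cong₂ _+ₚ_ (map-scale a q) (cong₂ _∷_ φ-0# (map-⊛ p q)) ⟩
      scale (φ a) (map φ q) +ₚ (0ℚ ∷ (map φ p *ₚ map φ q)) ∎
      where open ≡-Reasoning

    map-⊚ : ∀ f g → map φ (f ⊚ g) ≡ map φ f ∘ₚ map φ g
    map-⊚ []      g = refl
    map-⊚ (c ∷ f) g = begin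
      map φ ((c ∷ []) ⊕ (g ⊛ (f ⊚ g)))             ≡⟨ map-⊕ (c ∷ []) (g ⊛ (f ⊚ g)) ⟩
      (φ c ∷ []) +ₚ map φ (g ⊛ (f ⊚ g))            ≡⟨ cong ((φ c ∷ []) +ₚ_) (map-⊛ g (f ⊚ g)) ⟩
      (φ c ∷ []) +ₚ (map φ g *ₚ map φ (f ⊚ g))     ≡⟨ cong (λ t → (φ c ∷ []) +ₚ (map φ g *ₚ t)) (map-⊚ f g) ⟩
      (φ c ∷ []) +ₚ (map φ g *ₚ (map φ f ∘ₚ map φ g)) ∎
      where open ≡-Reasoning

open CoefficientLists (+ 0) ℤ._+_ ℤ._*_ using () renaming (_⊕_ to _+ᵃ_; _⊛_ to _*ᵃ_)

evalℤ : List ℤ → ℤ → ℤ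
evalℤ []      a = + 0
evalℤ (c ∷ p) a = c ℤ.+ a ℤ.* evalℤ p a

evalℤ-+ᵃ : ∀ p q a → evalℤ (p +ᵃ q) a ≡ evalℤ p a ℤ.+ evalℤ q a
evalℤ-+ᵃ []      q       a = sym (ℤ.+-identityˡ _)
evalℤ-+ᵃ (x ∷ p) []      a = sym (ℤ.+-identityʳ _)
evalℤ-+ᵃ (x ∷ p) (y ∷ q) a = trans (cong (λ t → x ℤ.+ y ℤ.+ a ℤ.* t) (evalℤ-+ᵃ p q a)) (regroup x y a _ _)
  where
  regroup : ∀ x y a s t → x ℤ.+ y ℤ.+ a ℤ.* (s ℤ.+ t) ≡ x ℤ.+ a ℤ.* s ℤ.+ (y ℤ.+ a ℤ.* t)
  regroup = solve-∀

evalℤ-scale : ∀ c q a → evalℤ (map (c ℤ.*_) q) a ≡ c ℤ.* evalℤ q a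
evalℤ-scale c []      a = sym (ℤ.*-zeroʳ c)
evalℤ-scale c (y ∷ q) a = trans (cong (λ t → c ℤ.* y ℤ.+ a ℤ.* t) (evalℤ-scale c q a)) (regroup c y a _)
  where
  regroup : ∀ c y a t → c ℤ.* y ℤ.+ a ℤ.* (c ℤ.* t) ≡ c ℤ.* (y ℤ.+ a ℤ.* t)
  regroup = solve-∀

evalℤ-*ᵃ : ∀ p q a → evalℤ (p *ᵃ q) a ≡ evalℤ p a ℤ.* evalℤ q a
evalℤ-*ᵃ []      q a = refl
evalℤ-*ᵃ (x ∷ p) q a = begin
  evalℤ (map (x ℤ.*_) q +ᵃ (+ 0 ∷ (p *ᵃ q))) a                       ≡⟨ evalℤ-+ᵃ (map (x ℤ.*_) q) _ a ⟩
  evalℤ (map (x ℤ.*_) q) a ℤ.+ (+ 0 ℤ.+ a ℤ.* evalℤ (p *ᵃ q) a)      ≡⟨ cong₂ (λ s t → s ℤ.+ (+ 0 ℤ.+ a ℤ.* t)) (evalℤ-scale x q a) (evalℤ-*ᵃ p q a) ⟩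
  x ℤ.* evalℤ q a ℤ.+ (+ 0 ℤ.+ a ℤ.* (evalℤ p a ℤ.* evalℤ q a))      ≡⟨ regroup x a _ _ ⟩
  (x ℤ.+ a ℤ.* evalℤ p a) ℤ.* evalℤ q a                              ∎
  where
  open ≡-Reasoning
  regroup : ∀ x a s t → x ℤ.* t ℤ.+ (+ 0 ℤ.+ a ℤ.* (s ℤ.* t)) ≡ (x ℤ.+ a ℤ.* s) ℤ.* t
  regroup = solve-∀

trim : List ℤ → List ℤ
trim []      = []
trim (x ∷ p) with trim p
... | y ∷ ys = x ∷ y ∷ ys
... | []     with x ℤ.≟ + 0
...   | yes _ = []
...   | no _  = x ∷ []

evalℤ-trim : ∀ p a → evalℤ (trim p) a ≡ evalℤ p a
evalℤ-trim []      a = refl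
evalℤ-trim (x ∷ p) a with trim p | evalℤ-trim p a
... | y ∷ ys | trimmed = cong (λ t → x ℤ.+ a ℤ.* t) trimmed
... | []     | trimmed with x ℤ.≟ + 0
...   | yes refl = sym (trans (ℤ.+-identityˡ (a ℤ.* evalℤ p a)) (trans (cong (a ℤ.*_) (sym trimmed)) (ℤ.*-zeroʳ a)))
...   | no _     = cong (λ t → x ℤ.+ a ℤ.* t) trimmed

specialise : ℤ → List (List ℤ) → Poly
specialise a = map (λ c → ℤtoℚ (evalℤ c a))

open CoefficientLists [] _+ᵃ_ _*ᵃ_ using () renaming (_⊛_ to _*ₓ_; _⊚_ to _∘ₓ_)

module Specialisation (a : ℤ) = CoefficientLists.Homomorphism [] _+ᵃ_ _*ᵃ_ (λ c → ℤtoℚ (evalℤ c a)) refl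
  (λ p q → trans (cong ℤtoℚ (evalℤ-+ᵃ p q a)) (ℤtoℚ-+ (evalℤ p a) (evalℤ q a)))
  (λ p q → trans (cong ℤtoℚ (evalℤ-*ᵃ p q a)) (ℤtoℚ-* (evalℤ p a) (evalℤ q a)))

specialise-trim : ∀ a P → specialise a (map trim P) ≡ specialise a P
specialise-trim a P = trans (sym (List.map-∘ P)) (List.map-cong (λ c → cong ℤtoℚ (evalℤ-trim c a)) P)

-- The factorisation of f_a ∘ f_a

-- f_a, g_a and h_a as polynomials in x whose coefficients are polynomials in a, lowest degree
-- first; number literals in this block denote integers.
module _ where
  open import Agda.Builtin.FromNat using (Number; fromNat)
  open import Agda.Builtin.FromNeg using (Negative)
  open import Data.Unit using (tt)
  open import Data.Integer.Literals using (number; negative)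
  instance
    ℤ-number : Number ℤ
    ℤ-number = number
    ℤ-negative : Negative ℤ
    ℤ-negative = negative

  faₓ gₓ hₓ : List (List ℤ)
  faₓ = (0 ∷ 1 ∷ []) ∷ (-1 ∷ 4 ∷ []) ∷ (-2 ∷ -8 ∷ []) ∷ (0 ∷ -8 ∷ []) ∷ []
  gₓ  = (1 ∷ -4 ∷ -4 ∷ []) ∷ (2 ∷ 12 ∷ -16 ∷ []) ∷ (0 ∷ 16 ∷ 32 ∷ []) ∷ (0 ∷ 0 ∷ 32 ∷ []) ∷ []
  hₓ  = (0 ∷ 0 ∷ 2 ∷ []) ∷ (1 ∷ 0 ∷ 16 ∷ []) ∷ (-2 ∷ -4 ∷ []) ∷ (-4 ∷ -16 ∷ -160 ∷ []) ∷ (0 ∷ 32 ∷ []) ∷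
        (0 ∷ 32 ∷ 256 ∷ []) ∷ (0 ∷ 0 ∷ 128 ∷ []) ∷ []

-- ∘ₓ produces three trailing zero coefficients, and trim drops trailing zeros in ℤ[a].
faₓ∘faₓ-trimmed : map trim (faₓ ∘ₓ faₓ) ≡ map trim (gₓ *ₓ hₓ) ++ replicate 3 []
faₓ∘faₓ-trimmed = refl

coeff-++-zeros : ∀ p k n → coeff (p ++ replicate k 0ℚ) n ≡ coeff p n
coeff-++-zeros []      zero    n       = refl
coeff-++-zeros []      (suc k) zero    = refl
coeff-++-zeros []      (suc k) (suc n) = coeff-++-zeros [] k n
coeff-++-zeros (c ∷ p) k       zero    = refl
coeff-++-zeros (c ∷ p) k       (suc n) = coeff-++-zeros p k n

fa-specialise : ∀ a → fa a ≡ specialise a faₓ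
fa-specialise a = cong (map ℤtoℚ) (Pointwise-≡⇒≡ (c₀ a ∷ c₁ a ∷ c₂ a ∷ c₃ a ∷ []))
  where
  c₀ : ∀ a → a ≡ + 0 ℤ.+ a ℤ.* (+ 1 ℤ.+ a ℤ.* + 0)
  c₀ = solve-∀
  c₁ : ∀ a → + 4 ℤ.* a ℤ.- + 1 ≡ ℤ.- + 1 ℤ.+ a ℤ.* (+ 4 ℤ.+ a ℤ.* + 0)
  c₁ = solve-∀
  c₂ : ∀ a → ℤ.- (+ 8 ℤ.* a ℤ.+ + 2) ≡ ℤ.- + 2 ℤ.+ a ℤ.* (ℤ.- + 8 ℤ.+ a ℤ.* + 0)
  c₂ = solve-∀
  c₃ : ∀ a → ℤ.- (+ 8 ℤ.* a) ≡ + 0 ℤ.+ a ℤ.* (ℤ.- + 8 ℤ.+ a ℤ.* + 0)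
  c₃ = solve-∀

fa∘fa-factorisation : ∀ a → (fa a ∘ₚ fa a) ≈ₚ (specialise a gₓ *ₚ specialise a hₓ)
fa∘fa-factorisation a n = trans (cong (λ p → coeff p n) padded) (coeff-++-zeros (specialise a gₓ *ₚ specialise a hₓ) 3 n)
  where
  open ≡-Reasoning
  open Specialisation a
  padded : fa a ∘ₚ fa a ≡ (specialise a gₓ *ₚ specialise a hₓ) ++ replicate 3 0ℚ
  padded = begin
    fa a ∘ₚ fa a                                                   ≡⟨ cong₂ _∘ₚ_ (fa-specialise a) (fa-specialise a) ⟩
    specialise a faₓ ∘ₚ specialise a faₓ                           ≡⟨ sym (map-⊚ faₓ faₓ) ⟩
    specialise a (faₓ ∘ₓ faₓ)                                      ≡⟨ sym (specialise-trim a (faₓ ∘ₓ faₓ)) ⟩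
    specialise a (map trim (faₓ ∘ₓ faₓ))                           ≡⟨ cong (specialise a) faₓ∘faₓ-trimmed ⟩
    specialise a (map trim (gₓ *ₓ hₓ) ++ replicate 3 [])           ≡⟨ List.map-++ (λ c → ℤtoℚ (evalℤ c a)) (map trim (gₓ *ₓ hₓ)) (replicate 3 []) ⟩
    specialise a (map trim (gₓ *ₓ hₓ)) ++ replicate 3 0ℚ          ≡⟨ cong (_++ replicate 3 0ℚ) (specialise-trim a (gₓ *ₓ hₓ)) ⟩
    specialise a (gₓ *ₓ hₓ) ++ replicate 3 0ℚ                     ≡⟨ cong (_++ replicate 3 0ℚ) (map-⊛ gₓ hₓ) ⟩
    (specialise a gₓ *ₚ specialise a hₓ) ++ replicate 3 0ℚ        ∎

scaled-square≢0 : ∀ {a} c → a ≢ + 0 → c ≢ + 0 → ℤtoℚ (evalℤ (+ 0 ∷ + 0 ∷ c ∷ []) a) ≢ 0ℚ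
scaled-square≢0 {a} c a≢0 c≢0 eq =
  [ a≢0 , (λ a·c≡0 → [ a≢0 , c≢0 ]′ (ℤ.i*j≡0⇒i≡0∨j≡0 a a·c≡0)) ]′ (ℤ.i*j≡0⇒i≡0∨j≡0 a a·[a·c]≡0)
  where
  expand : ∀ a c → + 0 ℤ.+ a ℤ.* (+ 0 ℤ.+ a ℤ.* (c ℤ.+ a ℤ.* + 0)) ≡ a ℤ.* (a ℤ.* c)
  expand = solve-∀
  a·[a·c]≡0 : a ℤ.* (a ℤ.* c) ≡ + 0
  a·[a·c]≡0 = trans (sym (expand a c)) (ℤtoℚ-injective {j = + 0} eq)

fa∘fa-reducible : ∀ a → a ≢ + 0 → Reducible (fa a ∘ₚ fa a)
fa∘fa-reducible a a≢0 (_ , factors) =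
  [ (λ g-const → scaled-square≢0 (+ 32) a≢0 (λ ()) (g-const 3 (s≤s z≤n)))
  , (λ h-const → scaled-square≢0 (+ 128) a≢0 (λ ()) (h-const 6 (s≤s z≤n))) ]′
  (factors (specialise a gₓ) (specialise a hₓ) (fa∘fa-factorisation a))

theorem3p1 : (a : ℤ) → ¬ (+ 3 ∣ a) → Irreducible (fa a) × EmergentReducibility (fa a) 1
theorem3p1 a 3∤a = fa-irreducible a 3∤a , (λ { 0 _ → fa-irreducible a 3∤a ; (suc _) (s≤s ()) }) , fa∘fa-reducible a (3∤⇒≢0 a 3∤a)
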